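{- Let $\ell\ge0$ and $n\ge0$. Let $T_m(x)$ denote the Chebyshev polynomial of the first kind ($T_0=1$, $T_1=x$, $T_{m+1}=2xT_m-T_{m-1}$), and let $t^{(m)}_i$ be the coefficient of $x^i$ in $T_m(x)$. Then \[ \mathrm{ehr}(\mathcal{O}(I_{\ell+1}\oplus(I_1+I_1)),n)=\frac{1}{2^{\ell+2}}\left|t^{(\ell+2n+3)}_{\ell+3}\right|, \] i.e. it is $2^{ -(\ell+2)}$ times the $n$-th entry ($n\ge0$) of the $(\ell+4)$-th column of the unsigned triangle of coefficients of the Chebyshev polynomials $T_m$ (rising powers, zero entries omitted).
   Context: For a finite poset $(P,\preceq)$ on $[p]$, the order polytope $\mathcal{O}(P)\subset\mathbb{R}^p$ is defined by $0\le x_i\le 1$ and $x_i\le x_j$ whenever $i\prec j$, and $\mathrm{ehr}(\mathcal{O}(P),n)=|n\mathcal{O}(P)\cap\mathbb{Z}^p|$ for $n\ge1$, $\mathrm{ehr}(\mathcal{O}(P),0)=1$. $I_k$ is the $k$-element chain; $+$ is the direct sum (disjoint union, no relations across) and $\oplus$ the ordinal sum (disjoint union with every element of the first summand below every element of the second). -}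

module Defs where

open import Data.Bool using (Bool; true; false; _∧_; _∨_; not)
open import Data.Nat using (ℕ; zero; suc; _+_; _<ᵇ_; _≤ᵇ_)
open import Data.Fin using (Fin; toℕ; splitAt)
open import Data.Sum using (_⊎_; inj₁; inj₂)
open import Data.List using (List; []; _∷_; length; filterᵇ; allFin; concatMap; map)
open import Data.Vec using (Vec; []; _∷_; lookup)
open import Data.Integer using (ℤ; +_; -_; _-_; _*_)

record FinPoset : Set where
  field
    size : ℕ
    _≺_  : Fin size → Fin size → Bool
open FinPoset public

chain : ℕ → FinPoset
chain k = record { size = k ; _≺_ = λ i j → toℕ i <ᵇ toℕ j }

dirSum : FinPoset → FinPoset → FinPoset
dirSum P Q = record { size = size P + size Q ; _≺_ = rel }
  where
  rel : Fin (size P + size Q) → Fin (size P + size Q) → Bool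
  rel a b with splitAt (size P) a | splitAt (size P) b
  ... | inj₁ i | inj₁ j = _≺_ P i j
  ... | inj₂ i | inj₂ j = _≺_ Q i j
  ... | _      | _      = false

-- Ordinal sum P ⊕ Q (every element of P below every element of Q).
ordSum : FinPoset → FinPoset → FinPoset
ordSum P Q = record { size = size P + size Q ; _≺_ = rel }
  where
  rel : Fin (size P + size Q) → Fin (size P + size Q) → Bool
  rel a b with splitAt (size P) a | splitAt (size P) b
  ... | inj₁ i | inj₁ j = _≺_ P i j
  ... | inj₂ i | inj₂ j = _≺_ Q i j
  ... | inj₁ _ | inj₂ _ = true
  ... | inj₂ _ | inj₁ _ = false

allᵇ : {A : Set} → (A → Bool) → List A → Bool
allᵇ p []       = true
allᵇ p (x ∷ xs) = p x ∧ allᵇ p xs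

boxPoints : (p n : ℕ) → List (Vec ℕ p)
boxPoints zero    n = [] ∷ []
boxPoints (suc p) n =
  concatMap (λ v → map (λ (c : Fin (suc n)) → toℕ c ∷ v) (allFin (suc n))) (boxPoints p n)

inDilatedOrderPolytope : (P : FinPoset) → Vec ℕ (size P) → Bool
inDilatedOrderPolytope P x =
  allᵇ (λ i → allᵇ (λ j → not (_≺_ P i j) ∨ (lookup x i ≤ᵇ lookup x j)) (allFin (size P)))
      (allFin (size P))

-- ehr(O(P), n) = |n·O(P) ∩ ℤ^p| ; the bounds 0 ≤ x_i ≤ n are built into boxPoints.
-- (For n = 0 this gives 1, the single point 0, as in the paper's convention.)
ehrOrder : FinPoset → ℕ → ℕ
ehrOrder P n = length (filterᵇ (inDilatedOrderPolytope P) (boxPoints (size P) n))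

chebCoeff : ℕ → ℕ → ℤ
chebCoeff zero          zero    = + 1
chebCoeff zero          (suc i) = + 0
chebCoeff (suc zero)    zero    = + 0
chebCoeff (suc zero)    (suc zero) = + 1
chebCoeff (suc zero)    (suc (suc i)) = + 0
chebCoeff (suc (suc m)) zero    = - chebCoeff m zero
chebCoeff (suc (suc m)) (suc i) = (+ 2) * chebCoeff (suc m) i - chebCoeff m (suc i)

module Submission where

-- Count the points of n·O(I_k ⊕ Q) whose coordinates are all at least c. Fixing the
-- value x of the bottom element of I_(k+1) writes the count for I_(k+1) ⊕ Q as the sum,
-- over c ≤ x ≤ n, of the count for I_k ⊕ Q with lower bound x. The count only depends on
-- n − c, so for Q = I_1 + I_1 the numbers e(k, n) = ehr(O(I_k ⊕ Q), n) satisfy Pascal's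
-- rule e(k+1, n+1) = e(k, n+1) + e(k+1, n), with e(k, 0) = 1 and e(0, n) = (n+1)².
-- The coefficient of x^j in T_(j+2m) has sign (−1)^m, so the recurrence of the T_m makes
-- its absolute value g(j, m) satisfy g(j+1, m+1) = 2 g(j, m+1) + g(j+1, m), with
-- g(0, m) = 1 and g(j+1, 0) = 2^j. The two recurrences then give g(k+2, m) = 2^(k+1) e(k, m).

open import Defs
open import Data.Bool using (Bool; true; false; _∧_; _∨_; not; T)
open import Data.Bool.Properties using (∧-zeroʳ; ∧-identityʳ; ∧-assoc; T-∧)
open import Data.Empty using (⊥-elim)
open import Data.Fin using (Fin; toℕ; splitAt) renaming (zero to fzero; suc to fsuc)
open import Data.Integer using (∣_∣)
open import Data.List using (List; []; _∷_; _++_; map; length; filterᵇ; concatMap; tabulate; allFin)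
open import Data.List.Properties using (map-++; map-∘; map-cong; map-tabulate)
open import Data.Nat using (ℕ; zero; suc; _+_; _*_; _^_; _≤_; _<_; _≤ᵇ_; s≤s)
open import Data.Nat.ListAction using (sum)
open import Data.Nat.ListAction.Properties using (sum-++)
open import Data.Nat.Properties
  using ( +-identityʳ; *-identityˡ; *-identityʳ; *-zeroʳ; *-distribʳ-+; *-distribˡ-+; *-assoc
        ; +-assoc; +-comm; ≤-refl; ≤-trans; <⇒≤; m≤n⇒m≤1+n; ≤ᵇ⇒≤; ≤⇒≤ᵇ; +-commutativeSemigroup)
open import Data.Nat.Tactic.RingSolver using (solve-∀)
open import Data.Product using (_,_; proj₁)
open import Data.Sum using (inj₁; inj₂)
open import Data.Unit using (tt)
open import Data.Vec using (Vec; []; _∷_; lookup)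
open import Function using (_∘_; id)
open import Function.Bundles using (module Equivalence)
open import Relation.Binary.PropositionalEquality
open import Algebra.Properties.CommutativeSemigroup +-commutativeSemigroup
  using () renaming (interchange to +-interchange)
open ≡-Reasoning

-- Finite sums and lattice points of the box {0, …, n}^p

indicator : Bool → ℕ
indicator true  = 1
indicator false = 0

indicator-∧ : ∀ a b → indicator (a ∧ b) ≡ indicator a * indicator b
indicator-∧ true  b = sym (+-identityʳ _)
indicator-∧ false b = refl

sumBelow : ℕ → (ℕ → ℕ) → ℕ
sumBelow zero    f = 0
sumBelow (suc m) f = f 0 + sumBelow m (f ∘ suc)

sumBelow-cong : ∀ m {f g : ℕ → ℕ} → (∀ x → f x ≡ g x) → sumBelow m f ≡ sumBelow m g
sumBelow-cong zero    f≗g = refl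
sumBelow-cong (suc m) f≗g = cong₂ _+_ (f≗g 0) (sumBelow-cong m (f≗g ∘ suc))

sumBelow-+ : ∀ m (f g : ℕ → ℕ) → sumBelow m (λ x → f x + g x) ≡ sumBelow m f + sumBelow m g
sumBelow-+ zero    f g = refl
sumBelow-+ (suc m) f g = begin
  (f 0 + g 0) + sumBelow m (λ x → f (suc x) + g (suc x))
    ≡⟨ cong ((f 0 + g 0) +_) (sumBelow-+ m (f ∘ suc) (g ∘ suc)) ⟩
  (f 0 + g 0) + (sumBelow m (f ∘ suc) + sumBelow m (g ∘ suc))
    ≡⟨ +-interchange (f 0) (g 0) _ _ ⟩
  (f 0 + sumBelow m (f ∘ suc)) + (g 0 + sumBelow m (g ∘ suc)) ∎

sumBelow-*ʳ : ∀ m (f : ℕ → ℕ) a → sumBelow m (λ x → f x * a) ≡ sumBelow m f * a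
sumBelow-*ʳ zero    f a = refl
sumBelow-*ʳ (suc m) f a = begin
  f 0 * a + sumBelow m (λ x → f (suc x) * a) ≡⟨ cong (f 0 * a +_) (sumBelow-*ʳ m (f ∘ suc) a) ⟩
  f 0 * a + sumBelow m (f ∘ suc) * a         ≡⟨ *-distribʳ-+ a (f 0) _ ⟨
  (f 0 + sumBelow m (f ∘ suc)) * a           ∎

sumBelow-const : ∀ m a → sumBelow m (λ _ → a) ≡ m * a
sumBelow-const zero    a = refl
sumBelow-const (suc m) a = cong (a +_) (sumBelow-const m a)

sum-map-sumBelow : ∀ {A : Set} m (F : A → ℕ → ℕ) (xs : List A) →
  sum (map (λ v → sumBelow m (F v)) xs) ≡ sumBelow m (λ x → sum (map (λ v → F v x) xs))
sum-map-sumBelow m F []       = sym (trans (sumBelow-const m 0) (*-zeroʳ m))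
sum-map-sumBelow m F (v ∷ xs) = begin
  sumBelow m (F v) + sum (map (λ v → sumBelow m (F v)) xs)
    ≡⟨ cong (sumBelow m (F v) +_) (sum-map-sumBelow m F xs) ⟩
  sumBelow m (F v) + sumBelow m (λ x → sum (map (λ v → F v x) xs))
    ≡⟨ sumBelow-+ m (F v) _ ⟨
  sumBelow m (λ x → F v x + sum (map (λ v → F v x) xs)) ∎

sum-map-concatMap : ∀ {A B : Set} (f : B → ℕ) (g : A → List B) (xs : List A) →
  sum (map f (concatMap g xs)) ≡ sum (map (λ v → sum (map f (g v))) xs)
sum-map-concatMap f g []       = refl
sum-map-concatMap f g (v ∷ xs) = begin
  sum (map f (g v ++ concatMap g xs))
    ≡⟨ cong sum (map-++ f (g v) (concatMap g xs)) ⟩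
  sum (map f (g v) ++ map f (concatMap g xs))
    ≡⟨ sum-++ (map f (g v)) _ ⟩
  sum (map f (g v)) + sum (map f (concatMap g xs))
    ≡⟨ cong (sum (map f (g v)) +_) (sum-map-concatMap f g xs) ⟩
  sum (map f (g v)) + sum (map (λ v → sum (map f (g v))) xs) ∎

sum-tabulate-toℕ : ∀ m (f : ℕ → ℕ) → sum (tabulate {n = m} (f ∘ toℕ)) ≡ sumBelow m f
sum-tabulate-toℕ zero    f = refl
sum-tabulate-toℕ (suc m) f = cong (f 0 +_) (sum-tabulate-toℕ m (f ∘ suc))

sum-map-allFin : ∀ m (f : ℕ → ℕ) → sum (map (f ∘ toℕ) (allFin m)) ≡ sumBelow m f
sum-map-allFin m f = trans (cong sum (map-tabulate {n = m} id (f ∘ toℕ))) (sum-tabulate-toℕ m f)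

length-filterᵇ : ∀ {A : Set} (P : A → Bool) xs →
  length (filterᵇ P xs) ≡ sum (map (indicator ∘ P) xs)
length-filterᵇ P []       = refl
length-filterᵇ P (x ∷ xs) with P x
... | true  = cong suc (length-filterᵇ P xs)
... | false = length-filterᵇ P xs

count : (p n : ℕ) → (Vec ℕ p → Bool) → ℕ
count p n P = sum (map (indicator ∘ P) (boxPoints p n))

count-cong : ∀ p n {P Q : Vec ℕ p → Bool} → (∀ v → P v ≡ Q v) → count p n P ≡ count p n Q
count-cong p n P≗Q = cong sum (map-cong (cong indicator ∘ P≗Q) (boxPoints p n))

count-suc : ∀ p n (P : Vec ℕ (suc p) → Bool) →
  count (suc p) n P ≡ sumBelow (suc n) (λ x → count p n (λ w → P (x ∷ w)))
count-suc p n P = begin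
  sum (map (indicator ∘ P) (concatMap column (boxPoints p n)))
    ≡⟨ sum-map-concatMap (indicator ∘ P) column (boxPoints p n) ⟩
  sum (map (λ w → sum (map (indicator ∘ P) (column w))) (boxPoints p n))
    ≡⟨ cong sum (map-cong column-sum (boxPoints p n)) ⟩
  sum (map (λ w → sumBelow (suc n) (λ x → indicator (P (x ∷ w)))) (boxPoints p n))
    ≡⟨ sum-map-sumBelow (suc n) (λ w x → indicator (P (x ∷ w))) (boxPoints p n) ⟩
  sumBelow (suc n) (λ x → count p n (λ w → P (x ∷ w))) ∎
  where
  column : Vec ℕ p → List (Vec ℕ (suc p))
  column w = map (λ (c : Fin (suc n)) → toℕ c ∷ w) (allFin (suc n))
  column-sum : ∀ w →
    sum (map (indicator ∘ P) (column w)) ≡ sumBelow (suc n) (λ x → indicator (P (x ∷ w)))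
  column-sum w = trans (cong sum (sym (map-∘ (allFin (suc n)))))
                       (sum-map-allFin (suc n) (λ x → indicator (P (x ∷ w))))

count-guard : ∀ p n b (P : Vec ℕ p → Bool) →
  count p n (λ w → b ∧ P w) ≡ indicator b * count p n P
count-guard p n b P = begin
  sum (map (λ w → indicator (b ∧ P w)) (boxPoints p n))
    ≡⟨ cong sum (map-cong (λ w → indicator-∧ b (P w)) (boxPoints p n)) ⟩
  sum (map (λ w → indicator b * indicator (P w)) (boxPoints p n))
    ≡⟨ sum-map-*ˡ (indicator b) (indicator ∘ P) (boxPoints p n) ⟩
  indicator b * count p n P ∎
  where
  sum-map-*ˡ : ∀ {A : Set} a (f : A → ℕ) xs → sum (map (λ x → a * f x) xs) ≡ a * sum (map f xs)
  sum-map-*ˡ a f []       = sym (*-zeroʳ a)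
  sum-map-*ˡ a f (x ∷ xs) =
    trans (cong (a * f x +_) (sum-map-*ˡ a f xs)) (sym (*-distribˡ-+ a (f x) _))

ehrOrder≡count : ∀ P n → ehrOrder P n ≡ count (size P) n (inDilatedOrderPolytope P)
ehrOrder≡count P n = length-filterᵇ (inDilatedOrderPolytope P) (boxPoints (size P) n)

-- Adjoining a bottom element: I_(k+1) ⊕ Q

∧-redundantˡ : ∀ a b → (T a → T b) → b ∧ a ≡ a
∧-redundantˡ false b     _   = ∧-zeroʳ b
∧-redundantˡ true  true  _   = refl
∧-redundantˡ true  false a⇒b = ⊥-elim (a⇒b tt)

∧-congˡ-guarded : ∀ a {b c} → (T a → b ≡ c) → a ∧ b ≡ a ∧ c
∧-congˡ-guarded false _   = refl
∧-congˡ-guarded true  b≡c = b≡c tt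

allᵇ-cong : ∀ {A : Set} {p q : A → Bool} (xs : List A) →
  (∀ x → p x ≡ q x) → allᵇ p xs ≡ allᵇ q xs
allᵇ-cong []       p≗q = refl
allᵇ-cong (x ∷ xs) p≗q = cong₂ _∧_ (p≗q x) (allᵇ-cong xs p≗q)

allᵇ-tabulate : ∀ {A : Set} m (p : A → Bool) (f : Fin m → A) →
  allᵇ p (tabulate f) ≡ allᵇ (p ∘ f) (allFin m)
allᵇ-tabulate zero    p f = refl
allᵇ-tabulate (suc m) p f =
  cong (p (f fzero) ∧_) (trans (allᵇ-tabulate m p (f ∘ fsuc)) (sym (allᵇ-tabulate m (p ∘ f) fsuc)))

allAtLeast : ∀ {m} → ℕ → Vec ℕ m → Bool
allAtLeast c []      = true
allAtLeast c (x ∷ w) = (c ≤ᵇ x) ∧ allAtLeast c w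

allAtLeast-lookup : ∀ {m} c (w : Vec ℕ m) → allᵇ (λ j → c ≤ᵇ lookup w j) (allFin m) ≡ allAtLeast c w
allAtLeast-lookup c []      = refl
allAtLeast-lookup c (x ∷ w) = cong ((c ≤ᵇ x) ∧_)
  (trans (allᵇ-tabulate _ (λ j → c ≤ᵇ lookup (x ∷ w) j) fsuc) (allAtLeast-lookup c w))

allAtLeast-zero : ∀ {m} (w : Vec ℕ m) → allAtLeast 0 w ≡ true
allAtLeast-zero []      = refl
allAtLeast-zero (x ∷ w) = allAtLeast-zero w

allAtLeast-mono : ∀ {m c x} (w : Vec ℕ m) → c ≤ x → T (allAtLeast x w) → T (allAtLeast c w)
allAtLeast-mono []      c≤x _ = tt
allAtLeast-mono {c = c} {x} (y ∷ w) c≤x x≤w with Equivalence.to T-∧ x≤w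
... | x≤y , x≤rest = Equivalence.from T-∧
  (≤⇒≤ᵇ (≤-trans c≤x (≤ᵇ⇒≤ x y x≤y)) , allAtLeast-mono w c≤x x≤rest)

module _ (k : ℕ) (Q : FinPoset) where

  bottom-≺ : ∀ j → _≺_ (ordSum (chain (suc k)) Q) fzero (fsuc j) ≡ true
  bottom-≺ j with splitAt k j
  ... | inj₁ _ = refl
  ... | inj₂ _ = refl

  ⊀-bottom : ∀ i → _≺_ (ordSum (chain (suc k)) Q) (fsuc i) fzero ≡ false
  ⊀-bottom i with splitAt k i
  ... | inj₁ _ = refl
  ... | inj₂ _ = refl

  ≺-above-bottom : ∀ i j →
    _≺_ (ordSum (chain (suc k)) Q) (fsuc i) (fsuc j) ≡ _≺_ (ordSum (chain k) Q) i j
  ≺-above-bottom i j with splitAt k i | splitAt k j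
  ... | inj₁ _ | inj₁ _ = refl
  ... | inj₁ _ | inj₂ _ = refl
  ... | inj₂ _ | inj₁ _ = refl
  ... | inj₂ _ | inj₂ _ = refl

  inDilatedOrderPolytope-bottom : ∀ c (w : Vec ℕ (k + size Q)) →
    inDilatedOrderPolytope (ordSum (chain (suc k)) Q) (c ∷ w)
      ≡ allAtLeast c w ∧ inDilatedOrderPolytope (ordSum (chain k) Q) w
  inDilatedOrderPolytope-bottom c w =
    cong₂ _∧_ bottomRow (trans (allᵇ-tabulate _ row fsuc) (allᵇ-cong (allFin _) upperRow))
    where
    P = ordSum (chain (suc k)) Q
    v = c ∷ w
    row : Fin (suc (k + size Q)) → Bool
    row i = allᵇ (λ j → not (_≺_ P i j) ∨ (lookup v i ≤ᵇ lookup v j)) (allFin _)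
    bottomRow : row fzero ≡ allAtLeast c w
    bottomRow = begin
      allᵇ (λ j → not (_≺_ P fzero j) ∨ (c ≤ᵇ lookup v j)) (tabulate fsuc)
        ≡⟨ allᵇ-tabulate (k + size Q) (λ j → not (_≺_ P fzero j) ∨ (c ≤ᵇ lookup v j)) fsuc ⟩
      allᵇ (λ j → not (_≺_ P fzero (fsuc j)) ∨ (c ≤ᵇ lookup w j)) (allFin _)
        ≡⟨ allᵇ-cong (allFin _) (λ j → cong (λ b → not b ∨ (c ≤ᵇ lookup w j)) (bottom-≺ j)) ⟩
      allᵇ (λ j → c ≤ᵇ lookup w j) (allFin _)
        ≡⟨ allAtLeast-lookup c w ⟩
      allAtLeast c w ∎
    upperRow : ∀ i → row (fsuc i)
      ≡ allᵇ (λ j → not (_≺_ (ordSum (chain k) Q) i j) ∨ (lookup w i ≤ᵇ lookup w j)) (allFin _)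
    upperRow i rewrite ⊀-bottom i = trans
      (allᵇ-tabulate (k + size Q) (λ j → not (_≺_ P (fsuc i) j) ∨ (lookup w i ≤ᵇ lookup v j)) fsuc)
      (allᵇ-cong (allFin _) λ j →
        cong (λ b → not b ∨ (lookup w i ≤ᵇ lookup w j)) (≺-above-bottom i j))

countAtLeast : FinPoset → ℕ → ℕ → ℕ
countAtLeast P n c = count (size P) n (λ v → allAtLeast c v ∧ inDilatedOrderPolytope P v)

ehrOrder≡countAtLeast : ∀ P n → ehrOrder P n ≡ countAtLeast P n 0
ehrOrder≡countAtLeast P n = trans (ehrOrder≡count P n)
  (count-cong (size P) n (λ v → cong (_∧ inDilatedOrderPolytope P v) (sym (allAtLeast-zero v))))

countAtLeast-bottom : ∀ k Q n c →
  countAtLeast (ordSum (chain (suc k)) Q) n c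
    ≡ sumBelow (suc n) (λ x → indicator (c ≤ᵇ x) * countAtLeast (ordSum (chain k) Q) n x)
countAtLeast-bottom k Q n c =
  trans (count-suc (k + size Q) n _) (sumBelow-cong (suc n) λ x →
    trans (count-cong (k + size Q) n (split x)) (count-guard (k + size Q) n (c ≤ᵇ x) _))
  where
  split : ∀ x w →
    allAtLeast c (x ∷ w) ∧ inDilatedOrderPolytope (ordSum (chain (suc k)) Q) (x ∷ w)
      ≡ (c ≤ᵇ x) ∧ (allAtLeast x w ∧ inDilatedOrderPolytope (ordSum (chain k) Q) w)
  split x w = begin
    ((c ≤ᵇ x) ∧ allAtLeast c w) ∧ inDilatedOrderPolytope (ordSum (chain (suc k)) Q) (x ∷ w)
      ≡⟨ cong (((c ≤ᵇ x) ∧ allAtLeast c w) ∧_) (inDilatedOrderPolytope-bottom k Q x w) ⟩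
    ((c ≤ᵇ x) ∧ allAtLeast c w) ∧ (allAtLeast x w ∧ I)
      ≡⟨ ∧-assoc (c ≤ᵇ x) _ _ ⟩
    (c ≤ᵇ x) ∧ (allAtLeast c w ∧ (allAtLeast x w ∧ I))
      ≡⟨ ∧-congˡ-guarded (c ≤ᵇ x) (λ c≤x → ∧-redundantˡ (allAtLeast x w ∧ I) (allAtLeast c w)
           (allAtLeast-mono w (≤ᵇ⇒≤ c x c≤x) ∘ proj₁ ∘ Equivalence.to T-∧)) ⟩
    (c ≤ᵇ x) ∧ (allAtLeast x w ∧ I) ∎
    where
    I = inDilatedOrderPolytope (ordSum (chain k) Q) w

width : ℕ → ℕ → ℕ
width n c = sumBelow (suc n) (λ x → indicator (c ≤ᵇ x))

suc-≤ᵇ-suc : ∀ c x → (suc c ≤ᵇ suc x) ≡ (c ≤ᵇ x)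
suc-≤ᵇ-suc zero    x = refl
suc-≤ᵇ-suc (suc c) x = refl

width-shift : ∀ n c → width (suc n) (suc c) ≡ width n c
width-shift n c = sumBelow-cong (suc n) (cong indicator ∘ suc-≤ᵇ-suc c)

count-allAtLeast : ∀ p n c → count p n (allAtLeast c) ≡ width n c ^ p
count-allAtLeast zero    n c = refl
count-allAtLeast (suc p) n c = begin
  count (suc p) n (allAtLeast c)
    ≡⟨ count-suc p n (allAtLeast c) ⟩
  sumBelow (suc n) (λ x → count p n (λ w → (c ≤ᵇ x) ∧ allAtLeast c w))
    ≡⟨ sumBelow-cong (suc n) (λ x → count-guard p n (c ≤ᵇ x) (allAtLeast c)) ⟩
  sumBelow (suc n) (λ x → indicator (c ≤ᵇ x) * count p n (allAtLeast c))
    ≡⟨ cong (λ y → sumBelow (suc n) (λ x → indicator (c ≤ᵇ x) * y)) (count-allAtLeast p n c) ⟩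
  sumBelow (suc n) (λ x → indicator (c ≤ᵇ x) * width n c ^ p)
    ≡⟨ sumBelow-*ʳ (suc n) (λ x → indicator (c ≤ᵇ x)) (width n c ^ p) ⟩
  width n c * width n c ^ p ∎

-- The poset I_k ⊕ (I_1 + I_1)

antichain₂ : FinPoset
antichain₂ = dirSum (chain 1) (chain 1)

fork : ℕ → FinPoset
fork k = ordSum (chain k) antichain₂

countAtLeast-fork-zero : ∀ n c → countAtLeast (fork 0) n c ≡ width n c * width n c
countAtLeast-fork-zero n c = begin
  countAtLeast (fork 0) n c      ≡⟨ count-cong 2 n unconstrained ⟩
  count 2 n (allAtLeast c)       ≡⟨ count-allAtLeast 2 n c ⟩
  width n c * (width n c * 1)    ≡⟨ cong (width n c *_) (*-identityʳ (width n c)) ⟩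
  width n c * width n c          ∎
  where
  unconstrained : ∀ v → allAtLeast c v ∧ inDilatedOrderPolytope (fork 0) v ≡ allAtLeast c v
  unconstrained (a ∷ b ∷ []) = ∧-identityʳ _

countAtLeast-fork-shift : ∀ k n c →
  countAtLeast (fork k) (suc n) (suc c) ≡ countAtLeast (fork k) n c
countAtLeast-fork-shift zero n c = begin
  countAtLeast (fork 0) (suc n) (suc c)          ≡⟨ countAtLeast-fork-zero (suc n) (suc c) ⟩
  width (suc n) (suc c) * width (suc n) (suc c)  ≡⟨ cong (λ w → w * w) (width-shift n c) ⟩
  width n c * width n c                          ≡⟨ countAtLeast-fork-zero n c ⟨
  countAtLeast (fork 0) n c                      ∎
countAtLeast-fork-shift (suc k) n c = begin
  countAtLeast (fork (suc k)) (suc n) (suc c)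
    ≡⟨ countAtLeast-bottom k antichain₂ (suc n) (suc c) ⟩
  sumBelow (suc (suc n)) (λ x → indicator (suc c ≤ᵇ x) * countAtLeast (fork k) (suc n) x)
    -- the summand x = 0 is 0 by computation, since suc c ≤ᵇ 0 reduces to false
    ≡⟨ sumBelow-cong (suc n) (λ x →
         cong₂ (λ b y → indicator b * y) (suc-≤ᵇ-suc c x) (countAtLeast-fork-shift k n x)) ⟩
  sumBelow (suc n) (λ x → indicator (c ≤ᵇ x) * countAtLeast (fork k) n x)
    ≡⟨ countAtLeast-bottom k antichain₂ n c ⟨
  countAtLeast (fork (suc k)) n c ∎

ehr-fork : ℕ → ℕ → ℕ
ehr-fork k n = countAtLeast (fork k) n 0

ehr-fork-origin : ∀ k → ehr-fork k 0 ≡ 1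
ehr-fork-origin zero    = refl
ehr-fork-origin (suc k) = begin
  ehr-fork (suc k) 0         ≡⟨ countAtLeast-bottom k antichain₂ 0 0 ⟩
  (ehr-fork k 0 + 0) + 0     ≡⟨ trans (+-identityʳ _) (+-identityʳ _) ⟩
  ehr-fork k 0               ≡⟨ ehr-fork-origin k ⟩
  1                          ∎

ehr-fork-base : ∀ n → ehr-fork 0 n ≡ suc n * suc n
ehr-fork-base n = trans (countAtLeast-fork-zero n 0)
  (cong (λ w → w * w) (trans (sumBelow-const (suc n) 1) (*-identityʳ (suc n))))

ehr-fork-pascal : ∀ k n → ehr-fork (suc k) (suc n) ≡ ehr-fork k (suc n) + ehr-fork (suc k) n
ehr-fork-pascal k n = begin
  ehr-fork (suc k) (suc n)
    ≡⟨ countAtLeast-bottom k antichain₂ (suc n) 0 ⟩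
  -- indicator (0 ≤ᵇ x) * y computes to y + 0
  (ehr-fork k (suc n) + 0) + sumBelow (suc n) (λ x → countAtLeast (fork k) (suc n) (suc x) + 0)
    ≡⟨ cong₂ _+_ (+-identityʳ (ehr-fork k (suc n)))
                 (sumBelow-cong (suc n) (cong (_+ 0) ∘ countAtLeast-fork-shift k n)) ⟩
  ehr-fork k (suc n) + sumBelow (suc n) (λ x → countAtLeast (fork k) n x + 0)
    ≡⟨ cong (ehr-fork k (suc n) +_) (countAtLeast-bottom k antichain₂ n 0) ⟨
  ehr-fork k (suc n) + ehr-fork (suc k) n ∎


module Chebyshev where

  open import Data.Integer as ℤ using (+_; -1ℤ)
  import Data.Integer.Properties as ℤ
  import Data.Integer.Tactic.RingSolver as ℤ-Solver

  chebCoeff-aboveDegree : ∀ m i → m < i → chebCoeff m i ≡ + 0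
  chebCoeff-aboveDegree zero          (suc i)       _ = refl
  chebCoeff-aboveDegree (suc zero)    (suc (suc i)) _ = refl
  chebCoeff-aboveDegree (suc zero)    (suc zero)    (s≤s ())
  chebCoeff-aboveDegree (suc (suc m)) (suc i)       (s≤s 1+m<i)
    rewrite chebCoeff-aboveDegree (suc m) i 1+m<i
          | chebCoeff-aboveDegree m (suc i) (m≤n⇒m≤1+n (<⇒≤ 1+m<i)) = refl

  chebCoeff-leading : ∀ j → chebCoeff (suc j) (suc j) ≡ + (2 ^ j)
  chebCoeff-leading zero = refl
  chebCoeff-leading (suc j)
    rewrite chebCoeff-leading j | chebCoeff-aboveDegree j (suc (suc j)) (m≤n⇒m≤1+n ≤-refl)
    = trans (ℤ.+-identityʳ _) (sym (ℤ.pos-* 2 (2 ^ j)))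

  chebCoeff-recurrence : ∀ j m →
    chebCoeff (suc j + 2 * suc m) (suc j)
      ≡ + 2 ℤ.* chebCoeff (j + 2 * suc m) j ℤ.- chebCoeff (suc j + 2 * m) (suc j)
  chebCoeff-recurrence j m = begin
    chebCoeff (suc j + 2 * suc m) (suc j)
      ≡⟨ cong (λ k → chebCoeff k (suc j)) (index j m) ⟩
    + 2 ℤ.* chebCoeff (suc (suc j + 2 * m)) j ℤ.- chebCoeff (suc j + 2 * m) (suc j)
      ≡⟨ cong (λ k → + 2 ℤ.* chebCoeff k j ℤ.- chebCoeff (suc j + 2 * m) (suc j)) (index′ j m) ⟩
    + 2 ℤ.* chebCoeff (j + 2 * suc m) j ℤ.- chebCoeff (suc j + 2 * m) (suc j) ∎
    where
    index : ∀ j m → suc j + 2 * suc m ≡ suc (suc (suc j + 2 * m))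
    index = solve-∀
    index′ : ∀ j m → suc (suc j + 2 * m) ≡ j + 2 * suc m
    index′ = solve-∀

  chebTriangle : ℕ → ℕ → ℕ
  chebTriangle zero    m       = 1
  chebTriangle (suc j) zero    = 2 ^ j
  chebTriangle (suc j) (suc m) = 2 * chebTriangle j (suc m) + chebTriangle (suc j) m

  chebCoeff≡±chebTriangle : ∀ j m → chebCoeff (j + 2 * m) j ≡ -1ℤ ℤ.^ m ℤ.* + chebTriangle j m
  chebCoeff≡±chebTriangle zero zero = refl
  chebCoeff≡±chebTriangle zero (suc m) = begin
    chebCoeff (2 * suc m) 0            ≡⟨ cong (λ k → chebCoeff k 0) (index m) ⟩
    ℤ.- chebCoeff (2 * m) 0            ≡⟨ cong ℤ.-_ (chebCoeff≡±chebTriangle 0 m) ⟩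
    ℤ.- (-1ℤ ℤ.^ m ℤ.* + 1)            ≡⟨ ℤ.neg-distribˡ-* (-1ℤ ℤ.^ m) (+ 1) ⟩
    ℤ.- (-1ℤ ℤ.^ m) ℤ.* + 1            ≡⟨ cong (ℤ._* + 1) (sym (ℤ.-1*i≡-i (-1ℤ ℤ.^ m))) ⟩
    -1ℤ ℤ.^ suc m ℤ.* + 1              ∎
    where
    index : ∀ m → 2 * suc m ≡ suc (suc (2 * m))
    index = solve-∀
  chebCoeff≡±chebTriangle (suc j) zero = begin
    chebCoeff (suc j + 0) (suc j)  ≡⟨ cong (λ k → chebCoeff k (suc j)) (+-identityʳ (suc j)) ⟩
    chebCoeff (suc j) (suc j)      ≡⟨ chebCoeff-leading j ⟩
    + (2 ^ j)                      ≡⟨ sym (ℤ.*-identityˡ _) ⟩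
    ℤ.1ℤ ℤ.* + (2 ^ j)             ∎
  chebCoeff≡±chebTriangle (suc j) (suc m) = begin
    chebCoeff (suc j + 2 * suc m) (suc j)
      ≡⟨ chebCoeff-recurrence j m ⟩
    + 2 ℤ.* chebCoeff (j + 2 * suc m) j ℤ.- chebCoeff (suc j + 2 * m) (suc j)
      ≡⟨ cong₂ (λ a b → + 2 ℤ.* a ℤ.- b)
               (chebCoeff≡±chebTriangle j (suc m)) (chebCoeff≡±chebTriangle (suc j) m) ⟩
    + 2 ℤ.* (-1ℤ ℤ.^ suc m ℤ.* + a) ℤ.- -1ℤ ℤ.^ m ℤ.* + b
      ≡⟨ signs-agree (-1ℤ ℤ.^ m) (+ a) (+ b) ⟩
    -1ℤ ℤ.^ suc m ℤ.* (+ 2 ℤ.* + a ℤ.+ + b)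
      ≡⟨ cong (-1ℤ ℤ.^ suc m ℤ.*_)
              (sym (trans (ℤ.pos-+ (2 * a) b) (cong (ℤ._+ + b) (ℤ.pos-* 2 a)))) ⟩
    -1ℤ ℤ.^ suc m ℤ.* + (2 * a + b) ∎
    where
    a = chebTriangle j (suc m)
    b = chebTriangle (suc j) m
    signs-agree : ∀ s x y →
      + 2 ℤ.* ((-1ℤ ℤ.* s) ℤ.* x) ℤ.- s ℤ.* y ≡ (-1ℤ ℤ.* s) ℤ.* (+ 2 ℤ.* x ℤ.+ y)
    signs-agree = ℤ-Solver.solve-∀

  ∣chebCoeff∣≡chebTriangle : ∀ j m → ∣ chebCoeff (j + 2 * m) j ∣ ≡ chebTriangle j m
  ∣chebCoeff∣≡chebTriangle j m = begin
    ∣ chebCoeff (j + 2 * m) j ∣                   ≡⟨ cong ∣_∣ (chebCoeff≡±chebTriangle j m) ⟩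
    ∣ -1ℤ ℤ.^ m ℤ.* + chebTriangle j m ∣          ≡⟨ ℤ.abs-* (-1ℤ ℤ.^ m) _ ⟩
    ∣ -1ℤ ℤ.^ m ∣ * chebTriangle j m              ≡⟨ cong (_* chebTriangle j m) (∣-1^m∣≡1 m) ⟩
    1 * chebTriangle j m                          ≡⟨ *-identityˡ _ ⟩
    chebTriangle j m                              ∎
    where
    ∣-1^m∣≡1 : ∀ m → ∣ -1ℤ ℤ.^ m ∣ ≡ 1
    ∣-1^m∣≡1 zero    = refl
    ∣-1^m∣≡1 (suc m) = trans (ℤ.abs-* -1ℤ (-1ℤ ℤ.^ m)) (trans (+-identityʳ _) (∣-1^m∣≡1 m))

open Chebyshev using (chebTriangle; ∣chebCoeff∣≡chebTriangle)

chebTriangle-one : ∀ m → chebTriangle 1 m ≡ 1 + 2 * m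
chebTriangle-one zero    = refl
chebTriangle-one (suc m) = trans (cong (2 +_) (chebTriangle-one m)) (arith m)
  where
  arith : ∀ m → 2 + (1 + 2 * m) ≡ 1 + 2 * suc m
  arith = solve-∀

chebTriangle-two : ∀ m → chebTriangle 2 m ≡ 2 * (suc m * suc m)
chebTriangle-two zero    = refl
chebTriangle-two (suc m) =
  trans (cong₂ (λ a b → 2 * a + b) (chebTriangle-one (suc m)) (chebTriangle-two m)) (arith m)
  where
  arith : ∀ m → 2 * (1 + 2 * suc m) + 2 * (suc m * suc m) ≡ 2 * (suc (suc m) * suc (suc m))
  arith = solve-∀

chebTriangle≡ehr-fork : ∀ k m → chebTriangle (suc (suc k)) m ≡ 2 ^ suc k * ehr-fork k m
chebTriangle≡ehr-fork zero    m    =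
  trans (chebTriangle-two m) (cong (2 *_) (sym (ehr-fork-base m)))
chebTriangle≡ehr-fork (suc k) zero =
  sym (trans (cong (2 ^ suc (suc k) *_) (ehr-fork-origin (suc k))) (*-identityʳ _))
chebTriangle≡ehr-fork (suc k) (suc m) = begin
  2 * chebTriangle (suc (suc k)) (suc m) + chebTriangle (suc (suc (suc k))) m
    ≡⟨ cong₂ (λ a b → 2 * a + b)
             (chebTriangle≡ehr-fork k (suc m)) (chebTriangle≡ehr-fork (suc k) m) ⟩
  2 * (2 ^ suc k * ehr-fork k (suc m)) + 2 ^ suc (suc k) * ehr-fork (suc k) m
    ≡⟨ cong (_+ 2 ^ suc (suc k) * ehr-fork (suc k) m) (*-assoc 2 (2 ^ suc k) _) ⟨
  2 ^ suc (suc k) * ehr-fork k (suc m) + 2 ^ suc (suc k) * ehr-fork (suc k) m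
    ≡⟨ *-distribˡ-+ (2 ^ suc (suc k)) _ _ ⟨
  2 ^ suc (suc k) * (ehr-fork k (suc m) + ehr-fork (suc k) m)
    ≡⟨ cong (2 ^ suc (suc k) *_) (ehr-fork-pascal k m) ⟨
  2 ^ suc (suc k) * ehr-fork (suc k) (suc m) ∎

proposition4p8 : (ℓ n : ℕ) →
    2 ^ (ℓ + 2) * ehrOrder (ordSum (chain (ℓ + 1)) (dirSum (chain 1) (chain 1))) n
      ≡ ∣ chebCoeff (ℓ + 2 * n + 3) (ℓ + 3) ∣
proposition4p8 ℓ n = begin
  2 ^ (ℓ + 2) * ehrOrder (fork (ℓ + 1)) n
    ≡⟨ cong₂ (λ e k → 2 ^ e * ehrOrder (fork k) n) (+-comm ℓ 2) (+-comm ℓ 1) ⟩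
  2 ^ (2 + ℓ) * ehrOrder (fork (1 + ℓ)) n
    ≡⟨ cong (2 ^ (2 + ℓ) *_) (ehrOrder≡countAtLeast (fork (1 + ℓ)) n) ⟩
  2 ^ (2 + ℓ) * ehr-fork (1 + ℓ) n
    ≡⟨ chebTriangle≡ehr-fork (1 + ℓ) n ⟨
  chebTriangle (3 + ℓ) n
    ≡⟨ ∣chebCoeff∣≡chebTriangle (3 + ℓ) n ⟨
  ∣ chebCoeff (3 + ℓ + 2 * n) (3 + ℓ) ∣
    ≡⟨ cong₂ (λ d i → ∣ chebCoeff d i ∣)
             (trans (+-assoc 3 ℓ (2 * n)) (+-comm 3 (ℓ + 2 * n))) (+-comm 3 ℓ) ⟩
  ∣ chebCoeff (ℓ + 2 * n + 3) (ℓ + 3) ∣ ∎
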